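{- Let $n\in\mathbb{N}$. If a finite set $X$ is $\omega^{n(n+1)/2}$-large$(\theta)$, then it is $\omega^n$-large${}^*(\theta)$.
   Context: Fix a $\Delta^0_0$ formula $\theta(x,y,z)$. For finite sets, $A<B$ means every element of $A$ is below every element of $B$. Finite sets $E<F$ are $\theta$-apart if $\forall x<\max E\ \exists y<\min F\ \forall z<\max F\ \theta(x,y,z)$. Largeness$(\theta)$: $F$ is $\omega^0$-large$(\theta)$ if $F\neq\emptyset$; $\omega^{n+1}$-large$(\theta)$ if $F\setminus\{\min F\}$ is $\omega^n\cdot\min F$-large$(\theta)$; $\omega^n\cdot k$-large$(\theta)$ if there are $k$ pairwise $\theta$-apart $\omega^n$-large$(\theta)$ subsets $F_0<\dots<F_{k-1}$ of $F$. Largeness${}^*(\theta)$: for a family $\mathcal{L}$ of finite sets and $k\in\mathbb{N}$, $\mathcal{L}\cdot k$ is the family of finite sets containing $k$ pairwise $\theta$-apart sets $X_0<\dots<X_{k-1}$ each in $\mathcal{L}$; $\mathcal{L}\cdot()=\mathcal{L}$, $\mathcal{L}\cdot(k,k_2,\dots,k_s)=(\mathcal{L}\cdot k)\cdot(k_2,\dots,k_s)$. $L^\theta_0$ is the nonempty finite sets; $L^\theta_{n+1}$ is the nonempty finite $X$ with $X\setminus\{\min X\}\in L^\theta_n\cdot(\min X,\dots,\min X)$ ($n+1$ entries). $X$ is $\omega^n$-large${}^*(\theta)$ if $X\in L^\theta_n$. -}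

module Defs where

open import Data.Nat using (ℕ; zero; suc; _<_)
open import Data.List using (List; []; _∷_; length; replicate)
open import Data.List.Relation.Unary.All using (All)
open import Data.List.Relation.Unary.AllPairs using (AllPairs)
open import Data.List.Relation.Unary.Linked using (Linked)
open import Data.List.Membership.Propositional using (_∈_)
open import Data.List.Relation.Binary.Subset.Propositional using (_⊆_)
open import Data.Product using (Σ; ∃; _×_)
open import Relation.Binary.PropositionalEquality using (_≡_)

-- A finite set of naturals is represented by its strictly increasing
-- enumeration (a list sorted by _<_).
FinSet : List ℕ → Set
FinSet X = Linked _<_ X

data NonEmpty : List ℕ → Set where
  nonempty : ∀ {x xs} → NonEmpty (x ∷ xs)

minS : List ℕ → ℕ
minS []      = 0
minS (x ∷ _) = x

maxS : List ℕ → ℕ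
maxS []           = 0
maxS (x ∷ [])     = x
maxS (_ ∷ y ∷ ys) = maxS (y ∷ ys)

dropMin : List ℕ → List ℕ
dropMin []       = []
dropMin (_ ∷ xs) = xs

_<ˢ_ : List ℕ → List ℕ → Set
A <ˢ B = ∀ {a b} → a ∈ A → b ∈ B → a < b

module _ (θ : ℕ → ℕ → ℕ → Set) where

  Apart : List ℕ → List ℕ → Set
  Apart E F = ∀ x → x < maxS E → Σ ℕ λ y → y < minS F × (∀ z → z < maxS F → θ x y z)

  OrdApart : List ℕ → List ℕ → Set
  OrdApart E F = (E <ˢ F) × Apart E F

  Mul : (List ℕ → Set) → ℕ → List ℕ → Set
  Mul L k F = Σ (List (List ℕ)) λ Fs →
      length Fs ≡ k
    × All FinSet Fs
    × All (λ G → G ⊆ F) Fs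
    × All L Fs
    × AllPairs OrdApart Fs

  Large : ℕ → List ℕ → Set
  Large zero    F = NonEmpty F
  Large (suc n) F = NonEmpty F × Mul (Large n) (minS F) (dropMin F)

  MulList : (List ℕ → Set) → List ℕ → List ℕ → Set
  MulList L []       = L
  MulList L (k ∷ ks) = MulList (Mul L k) ks

  Lstar : ℕ → List ℕ → Set
  Lstar zero    X = NonEmpty X
  Lstar (suc n) X = NonEmpty X × MulList (Lstar n) (replicate (suc n) (minS X)) (dropMin X)

  LargeStar : ℕ → List ℕ → Set
  LargeStar n X = Lstar n X

-- An ω^(k+a)-large set with minimum x contains x pairwise apart
-- ω^(k-1+a)-large subsets above x.  Unfolding this k times inside a set whose
-- elements are all ≥ m, and keeping only m pieces at each step (there are at
-- least m, since every minimum involved is ≥ m), gives membership in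
-- (ω^a-large)·(m,…,m) with k entries.  As n(n+1)/2 = 1 + (n-1) + (n-1)n/2,
-- an ω^(n(n+1)/2)-large X with minimum x has x apart pieces in
-- (ω^((n-1)n/2)-large)·(x,…,x) with n-1 entries; induction on n replaces
-- ω^((n-1)n/2)-large by L_(n-1), and the outer split is the last factor x.
module Submission where

open import Defs
open import Data.Nat using (ℕ; zero; suc; _+_; _*_; _≤_; _<_)
open import Data.Nat.Properties using (<-trans; <⇒≤; m≤n⇒m⊓n≡m)
open import Data.Nat.DivMod using (_/_; m*n/n≡m)
open import Data.Nat.Tactic.RingSolver using (solve-∀)
open import Data.List using (List; []; _∷_; replicate; take)
open import Data.List.Properties using (length-take)
open import Data.List.Relation.Unary.All as All using (All)
import Data.List.Relation.Unary.All.Properties as All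
import Data.List.Relation.Unary.AllPairs.Properties as AllPairs
open import Data.List.Relation.Unary.Linked using ([-]; _∷_)
open import Data.List.Relation.Unary.Linked.Properties using (Linked⇒All)
open import Data.List.Relation.Unary.Any using (here; there)
open import Data.List.Membership.Propositional using (_∈_)
open import Data.List.Relation.Binary.Subset.Propositional using (_⊆_)
open import Data.List.Relation.Binary.Subset.Propositional.Properties using (⊆-trans)
open import Data.Product using (_,_)
open import Relation.Binary.PropositionalEquality
  using (_≡_; refl; sym; trans; cong; subst; module ≡-Reasoning)
open import Relation.Nullary using (Dec)

-- triangle (suc n) is written as suc (n + triangle n) so that
-- Large θ (triangle (suc n)) unfolds by one step of the definition of Large.
triangle : ℕ → ℕ
triangle zero    = 0
triangle (suc n) = suc (n + triangle n)

triangle*2 : ∀ n → triangle n * 2 ≡ n * suc n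
triangle*2 zero    = refl
triangle*2 (suc n) = begin
  suc (n + triangle n) * 2         ≡⟨ expand n (triangle n) ⟩
  2 + n * 2 + triangle n * 2       ≡⟨ cong (λ t → 2 + n * 2 + t) (triangle*2 n) ⟩
  2 + n * 2 + n * suc n            ≡⟨ sym (collect n) ⟩
  suc n * suc (suc n)              ∎
  where
  open ≡-Reasoning
  expand : ∀ n t → suc (n + t) * 2 ≡ 2 + n * 2 + t * 2
  expand = solve-∀
  collect : ∀ n → suc n * suc (suc n) ≡ 2 + n * 2 + n * suc n
  collect = solve-∀

n*[1+n]/2≡triangle : ∀ n → (n * suc n) / 2 ≡ triangle n
n*[1+n]/2≡triangle n = trans (cong (_/ 2) (sym (triangle*2 n))) (m*n/n≡m (triangle n) 2)

Above : ℕ → List ℕ → Set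
Above m Z = ∀ {z} → z ∈ Z → m ≤ z

Above-⊆ : ∀ {m Y Z} → Z ⊆ Y → Above m Y → Above m Z
Above-⊆ Z⊆Y m≤Y z∈Z = m≤Y (Z⊆Y z∈Z)

FinSet-head< : ∀ {x X z} → FinSet (x ∷ X) → z ∈ X → x < z
FinSet-head< [-]          ()
FinSet-head< (x<y ∷ sorted) z∈X = All.lookup (Linked⇒All <-trans x<y sorted) z∈X

module _ (θ : ℕ → ℕ → ℕ → Set) where

  Mul-map : ∀ {L L' : List ℕ → Set} {k F}
          → (∀ {Z} → FinSet Z → Z ⊆ F → L Z → L' Z) → Mul θ L k F → Mul θ L' k F
  Mul-map f (Fs , len , fin , sub , ls , apart) =
    Fs , len , fin , sub ,
    All.zipWith (λ ((finZ , subZ) , lZ) → f finZ subZ lZ) (All.zip (fin , sub) , ls) ,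
    apart

  Mul-⊆ : ∀ {L : List ℕ → Set} {k F G} → F ⊆ G → Mul θ L k F → Mul θ L k G
  Mul-⊆ F⊆G (Fs , len , fin , sub , ls , apart) =
    Fs , len , fin , All.map {P = _⊆ _} {Q = _⊆ _} (λ Z⊆F → ⊆-trans Z⊆F F⊆G) sub , ls , apart

  Mul-≤ : ∀ {L : List ℕ → Set} {k k' F} → k' ≤ k → Mul θ L k F → Mul θ L k' F
  Mul-≤ {k' = k'} k'≤k (Fs , refl , fin , sub , ls , apart) =
    take k' Fs , trans (length-take k' Fs) (m≤n⇒m⊓n≡m k'≤k) ,
    All.take⁺ k' fin , All.take⁺ k' sub , All.take⁺ k' ls , AllPairs.take⁺ k' apart

  MulList-map : ∀ {L L' : List ℕ → Set} ks {Y} → FinSet Y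
              → (∀ {Z} → FinSet Z → L Z → L' Z) → MulList θ L ks Y → MulList θ L' ks Y
  MulList-map []       finY f = f finY
  MulList-map (k ∷ ks) finY f = MulList-map ks finY (λ _ → Mul-map (λ finZ _ → f finZ))

  MulList-replicate-suc : ∀ {L : List ℕ → Set} k {m W}
                        → Mul θ (MulList θ L (replicate k m)) m W
                        → MulList θ L (replicate (suc k) m) W
  MulList-replicate-suc zero    mul = mul
  MulList-replicate-suc (suc k) mul = MulList-replicate-suc k mul

  Large⇒MulList : ∀ {m a} k {Y} → FinSet Y → Above m Y
                → Large θ (k + a) Y → MulList θ (Large θ a) (replicate k m) Y
  Large⇒MulList zero _ _ large = large
  Large⇒MulList {m} {a} (suc k) {y ∷ Y} _ m≤Y (_ , pieces) =
    MulList-replicate-suc k (Mul-⊆ there (Mul-≤ (m≤Y (here refl)) (Mul-map piece pieces)))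
    where
    piece : ∀ {Z} → FinSet Z → Z ⊆ Y → Large θ (k + a) Z
          → MulList θ (Large θ a) (replicate k m) Z
    piece finZ Z⊆Y = Large⇒MulList k finZ (Above-⊆ (⊆-trans Z⊆Y there) m≤Y)

  Large-triangle⇒LargeStar : ∀ n {X} → FinSet X → Large θ (triangle n) X → LargeStar θ n X
  Large-triangle⇒LargeStar zero    _ large = large
  Large-triangle⇒LargeStar (suc n) {x ∷ X} finX (nonempty , pieces) =
    nonempty , MulList-replicate-suc n (Mul-map piece pieces)
    where
    piece : ∀ {Z} → FinSet Z → Z ⊆ X → Large θ (n + triangle n) Z
          → MulList θ (Lstar θ n) (replicate n x) Z
    piece finZ Z⊆X large =
      MulList-map (replicate n x) finZ (Large-triangle⇒LargeStar n)
        (Large⇒MulList n finZ (λ z∈Z → <⇒≤ (FinSet-head< finX (Z⊆X z∈Z))) large)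

proposition3p6 : (θ : ℕ → ℕ → ℕ → Set) → (∀ x y z → Dec (θ x y z))
    → (n : ℕ) (X : List ℕ) → FinSet X
    → Large θ ((n * suc n) / 2) X → LargeStar θ n X
proposition3p6 θ _ n X finX large =
  Large-triangle⇒LargeStar θ n finX (subst (λ b → Large θ b X) (n*[1+n]/2≡triangle n) large)
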